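{- For a hypergraph $\mathcal{H}$, the following are equivalent: (1) $\mathcal{H}$ is a Sperner hypergraph whose dual hypergraph $\mathcal{H}^d$ is conformal; (2) there exists a graph $G$ such that $\mathcal{H}$ is the hypergraph (on vertex set $V(G)$) whose hyperedges are exactly the minimal clique transversals of $G$.
   Context: A hypergraph is a pair $\mathcal{H}=(V,E)$ with $V$ a finite nonempty set and $E$ a set of subsets of $V$ (hyperedges) such that every vertex lies in some hyperedge. It is Sperner if no hyperedge contains another. A transversal is a set of vertices meeting every hyperedge; minimal if no proper subset is a transversal. The dual $\mathcal{H}^d$ has vertex set $V$ and hyperedges the minimal transversals of $\mathcal{H}$. A hypergraph is conformal if for every set $U$ of vertices such that every pair of vertices of $U$ lies in a common hyperedge, $U$ is contained in some hyperedge. For a finite simple graph $G$, a clique transversal is a set of vertices intersecting every maximal clique; it is minimal if no proper subset is a clique transversal. -}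

module Defs where

open import Data.Nat using (ℕ)
open import Data.Bool using (Bool; true)
open import Data.Fin using (Fin)
open import Data.Fin.Subset using (Subset; _∈_; _⊆_)
open import Data.Product using (Σ; ∃; _×_)
open import Relation.Binary.PropositionalEquality using (_≡_; _≢_)
open import Relation.Nullary using (¬_)

record Hypergraph (n : ℕ) : Set where
  field
    edge   : Subset n → Bool
    covers : ∀ (v : Fin n) → ∃ λ (S : Subset n) → edge S ≡ true × v ∈ S

open Hypergraph public

Sperner : ∀ {n} → Hypergraph n → Set
Sperner H = ∀ S T → edge H S ≡ true → edge H T ≡ true → S ⊆ T → S ≡ T

Meets : ∀ {n} → Subset n → Subset n → Set
Meets {n} T S = ∃ λ (v : Fin n) → v ∈ T × v ∈ S

Transversal : ∀ {n} → Hypergraph n → Subset n → Set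
Transversal H T = ∀ S → edge H S ≡ true → Meets T S

MinimalTransversal : ∀ {n} → Hypergraph n → Subset n → Set
MinimalTransversal H T =
  Transversal H T × (∀ T' → T' ⊆ T → Transversal H T' → T' ≡ T)

Conformal : ∀ {n} → (Subset n → Set) → Set
Conformal {n} P =
  ∀ (U : Subset n) →
    (∀ (u v : Fin n) → u ∈ U → v ∈ U → u ≢ v →
       ∃ λ (S : Subset n) → P S × u ∈ S × v ∈ S) →
    ∃ λ (S : Subset n) → P S × U ⊆ S

DualEdge : ∀ {n} → Hypergraph n → Subset n → Set
DualEdge H = MinimalTransversal H

record Graph (n : ℕ) : Set where
  field
    adj     : Fin n → Fin n → Bool
    adj-sym : ∀ u v → adj u v ≡ adj v u
    irrefl  : ∀ v → ¬ (adj v v ≡ true)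

open Graph public

Clique : ∀ {n} → Graph n → Subset n → Set
Clique G K = ∀ u v → u ∈ K → v ∈ K → u ≢ v → adj G u v ≡ true

MaximalClique : ∀ {n} → Graph n → Subset n → Set
MaximalClique G K = Clique G K × (∀ K' → Clique G K' → K ⊆ K' → K' ≡ K)

CliqueTransversal : ∀ {n} → Graph n → Subset n → Set
CliqueTransversal G T = ∀ K → MaximalClique G K → Meets T K

MinimalCliqueTransversal : ∀ {n} → Graph n → Subset n → Set
MinimalCliqueTransversal G T =
  CliqueTransversal G T × (∀ T' → T' ⊆ T → CliqueTransversal G T' → T' ≡ T)

{-# OPTIONS --safe #-}
-- Two classical facts do the work. (i) Duality of Sperner families: the minimal
-- transversals of the minimal transversals of a Sperner family are the family
-- itself, because each vertex v of an edge S lies on a minimal transversal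
-- inside ∁ S ∪ ⁅ v ⁆. (ii) A Sperner family is the family of maximal cliques of
-- some graph exactly when it is conformal, the graph being its 2-section.
-- If H is Sperner and H^d conformal, let G be the 2-section of H^d; then the
-- maximal cliques of G form H^d, and its minimal clique transversals form
-- (H^d)^d = H. Conversely, if H consists of the minimal clique transversals of G,
-- then H is Sperner and H^d is the family of maximal cliques of G, which is
-- conformal.
module Submission where

open import Defs
open import Data.Nat using (ℕ; suc)
open import Data.Bool using (true)
import Data.Bool as Bool
open import Data.Fin using (Fin; _≟_)
open import Data.Fin.Properties using (any?; all?)
open import Data.Fin.Subset using (Subset; _∈_; _⊆_; _⊇_; _⊂_; _⊃_; ∁; _∪_; ⁅_⁆)
open import Data.Fin.Subset.Properties
  using (_∈?_; _⊆?_; _⊂?_; anySubset?; ⊆-antisym; ⊆-trans; x∈p∪q⁺; x∈p∪q⁻;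
         x∈⁅x⁆; x∈⁅y⁆⇒x≡y; x∉p⇒x∈∁p; x∈∁p⇒x∉p)
open import Data.Fin.Subset.Induction using (⊂-wellFounded; ⊃-wellFounded)
open import Data.Vec.Properties using (≡-dec)
open import Data.Product using (∃; _×_; _,_; proj₁; proj₂; map₁; map₂)
open import Data.Sum using (_⊎_; inj₁; inj₂)
open import Data.Empty using (⊥-elim)
open import Function.Base using (id; _∘_)
open import Function.Bundles using (_⇔_; mk⇔; Equivalence)
open import Level using (0ℓ)
open import Induction.WellFounded using (WellFounded; Acc; acc)
open import Relation.Binary.Core using (Rel)
open import Relation.Binary.Definitions using (DecidableEquality; Reflexive; Trans)
import Relation.Binary.Definitions as Binary
open import Relation.Binary.PropositionalEquality using (_≡_; _≢_; refl; sym; subst)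
open import Relation.Nullary using (¬_; Dec; yes; no; does)
open import Relation.Nullary.Decidable
  using (_×-dec_; _→-dec_; ¬?; decidable-stable; dec-true; does-⇔)
open import Relation.Unary using (Pred; Decidable; _≐_)
open import Relation.Unary.Properties using (≐-sym; ≐-trans)

open Equivalence

private
  variable
    n : ℕ

Family : ℕ → Set₁
Family n = Pred (Subset n) 0ℓ

Minimal : Family n → Family n
Minimal P T = P T × (∀ T′ → T′ ⊆ T → P T′ → T′ ≡ T)

Maximal : Family n → Family n
Maximal P K = P K × (∀ K′ → P K′ → K ⊆ K′ → K′ ≡ K)

Antichain : Family n → Set
Antichain F = ∀ S T → F S → F T → S ⊆ T → S ≡ T

MeetsAll : Family n → Family n
MeetsAll F T = ∀ S → F S → Meets T S

Edge : Hypergraph n → Family n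
Edge H S = edge H S ≡ true

edge? : (H : Hypergraph n) → Decidable (Edge H)
edge? H S = edge H S Bool.≟ true

≐⇒⇔ : {P Q : Family n} → P ≐ Q → ∀ S → P S ⇔ Q S
≐⇒⇔ (P⊆Q , Q⊆P) S = mk⇔ P⊆Q Q⊆P

⇔⇒≐ : {P Q : Family n} → (∀ S → P S ⇔ Q S) → P ≐ Q
⇔⇒≐ P⇔Q = (λ {S} → to (P⇔Q S)) , (λ {S} → from (P⇔Q S))

does≡true⇒ : {A : Set} (a? : Dec A) → does a? ≡ true → A
does≡true⇒ (yes a) _ = a

_≟ₛ_ : DecidableEquality (Subset n)
_≟ₛ_ = ≡-dec Bool._≟_

allSubsets? : {P : Family n} → Decidable P → Dec (∀ S → P S)
allSubsets? P? with anySubset? (¬? ∘ P?)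
... | yes (S , ¬PS) = no λ ∀P → ¬PS (∀P S)
... | no ∄¬P = yes λ S → decidable-stable (P? S) λ ¬PS → ∄¬P (S , ¬PS)

meets? : (T S : Subset n) → Dec (Meets T S)
meets? T S = any? λ v → (v ∈? T) ×-dec (v ∈? S)

meetsAll? : {F : Family n} → Decidable F → Decidable (MeetsAll F)
meetsAll? F? T = allSubsets? λ S → F? S →-dec meets? T S

minimal? : {P : Family n} → Decidable P → Decidable (Minimal P)
minimal? P? T = P? T ×-dec allSubsets? λ T′ → (T′ ⊆? T) →-dec (P? T′ →-dec (T′ ≟ₛ T))

maximal? : {P : Family n} → Decidable P → Decidable (Maximal P)
maximal? P? K = P? K ×-dec allSubsets? λ K′ → P? K′ →-dec ((K ⊆? K′) →-dec (K′ ≟ₛ K))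

⊆∧⊄⇒≡ : {p q : Subset n} → p ⊆ q → ¬ (p ⊂ q) → p ≡ q
⊆∧⊄⇒≡ {p = p} p⊆q p⊄q = ⊆-antisym p⊆q λ {x} x∈q →
  decidable-stable (x ∈? p) λ x∉p → p⊄q (p⊆q , x , x∈q , x∉p)

module _ {_≺_ _⊑_ : Rel (Subset n) 0ℓ}
         (≺? : Binary.Decidable _≺_) (≺-wellFounded : WellFounded _≺_)
         (⊑-refl : Reflexive _⊑_) (⊑-≺-trans : Trans _⊑_ _≺_ _⊑_)
         {P : Family n} (P? : Decidable P) where

  ≺-minimal-⊑ : ∀ S → P S → ∃ λ T → T ⊑ S × P T × (∀ T′ → T′ ≺ T → ¬ P T′)
  ≺-minimal-⊑ S = go S (≺-wellFounded S)
    where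
    go : ∀ T → Acc _≺_ T → P T → ∃ λ T′ → T′ ⊑ T × P T′ × (∀ T″ → T″ ≺ T′ → ¬ P T″)
    go T (acc rec) PT with anySubset? (λ T′ → ≺? T′ T ×-dec P? T′)
    ... | no ∄smaller = T , ⊑-refl , PT , λ T′ T′≺T PT′ → ∄smaller (T′ , T′≺T , PT′)
    ... | yes (T′ , T′≺T , PT′) with go T′ (rec T′≺T) PT′
    ...   | T″ , T″⊑T′ , PT″ , least = T″ , ⊑-≺-trans T″⊑T′ T′≺T , PT″ , least

minimal-⊆ : {P : Family n} → Decidable P → ∀ S → P S → ∃ λ T → T ⊆ S × Minimal P T
minimal-⊆ P? S PS =
  let T , T⊆S , PT , least = ≺-minimal-⊑ {_⊑_ = _⊆_} _⊂?_ ⊂-wellFounded id ⊆-⊂-trans′ P? S PS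
  in T , T⊆S , PT , λ T′ T′⊆T PT′ → ⊆∧⊄⇒≡ T′⊆T λ T′⊂T → least T′ T′⊂T PT′
  where
  ⊆-⊂-trans′ : Trans _⊆_ _⊂_ _⊆_
  ⊆-⊂-trans′ T″⊆T′ T′⊂T = ⊆-trans T″⊆T′ (proj₁ T′⊂T)

maximal-⊇ : {P : Family n} → Decidable P → ∀ S → P S → ∃ λ K → Maximal P K × S ⊆ K
maximal-⊇ P? S PS =
  let K , S⊆K , PK , greatest =
        ≺-minimal-⊑ {_⊑_ = _⊇_} (λ p q → q ⊂? p) ⊃-wellFounded id ⊇-⊃-trans P? S PS
  in K , (PK , λ K′ PK′ K⊆K′ → sym (⊆∧⊄⇒≡ K⊆K′ λ K⊂K′ → greatest K′ K⊂K′ PK′)) , S⊆K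
  where
  ⊇-⊃-trans : Trans _⊇_ _⊃_ _⊇_
  ⊇-⊃-trans K″⊇K′ K′⊃K = ⊆-trans (proj₁ K′⊃K) K″⊇K′

minimal-antichain : {P : Family n} → Antichain (Minimal P)
minimal-antichain S T (PS , _) (_ , minT) S⊆T = minT S S⊆T PS

maximal-antichain : {P : Family n} → Antichain (Maximal P)
maximal-antichain S T (_ , maxS) (PT , _) S⊆T = sym (maxS T PT S⊆T)

⊆⊎meets-∁ : (X S : Subset n) → X ⊆ S ⊎ Meets (∁ S) X
⊆⊎meets-∁ X S with any? (λ w → (w ∈? X) ×-dec ¬? (w ∈? S))
... | yes (w , w∈X , w∉S) = inj₂ (w , x∉p⇒x∈∁p w∉S , w∈X)
... | no ∄w = inj₁ λ {w} w∈X → decidable-stable (w ∈? S) λ w∉S → ∄w (w , w∈X , w∉S)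

meets-sym : {T S : Subset n} → Meets T S → Meets S T
meets-sym (v , v∈T , v∈S) = v , v∈S , v∈T

Dual : Family n → Family n
Dual F = Minimal (MeetsAll F)

∁-meetsAll : {F : Family n} {S : Subset n} →
  ¬ (∃ λ E → F E × E ⊆ S) → MeetsAll F (∁ S)
∁-meetsAll {S = S} ∄E E FE with ⊆⊎meets-∁ E S
... | inj₁ E⊆S = ⊥-elim (∄E (E , FE , E⊆S))
... | inj₂ meets = meets

∁∪⁅⁆-meetsAll : {F : Family n} → Antichain F →
  ∀ {S v} → F S → v ∈ S → MeetsAll F (∁ S ∪ ⁅ v ⁆)
∁∪⁅⁆-meetsAll anti {S} {v} FS v∈S E FE with ⊆⊎meets-∁ E S
... | inj₁ E⊆S =
  v , x∈p∪q⁺ (inj₂ (x∈⁅x⁆ v)) , subst (v ∈_) (sym (anti E S FE FS E⊆S)) v∈S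
... | inj₂ (w , w∈∁S , w∈E) = w , x∈p∪q⁺ (inj₁ w∈∁S) , w∈E

edge-meetsAll-dual : {F : Family n} → ∀ {S} → F S → MeetsAll (Dual F) S
edge-meetsAll-dual FS T (T-meetsAll , _) = meets-sym (T-meetsAll _ FS)

module _ {F : Family n} (F? : Decidable F) where

  meetsAll-dual⇒⊇edge : ∀ {S} → MeetsAll (Dual F) S → ∃ λ E → F E × E ⊆ S
  meetsAll-dual⇒⊇edge {S} S-meetsAll with anySubset? (λ E → F? E ×-dec (E ⊆? S))
  ... | yes found = found
  ... | no ∄E with minimal-⊆ (meetsAll? F?) (∁ S) (∁-meetsAll ∄E)
  ...   | T , T⊆∁S , dualT with S-meetsAll T dualT
  ...     | w , w∈S , w∈T = ⊥-elim (x∈∁p⇒x∉p (T⊆∁S w∈T) w∈S)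

  dual-meets-only-at : Antichain F → ∀ {S v} → F S → v ∈ S →
    ∃ λ T → Dual F T × (∀ {w} → w ∈ T → w ∈ S → w ≡ v)
  dual-meets-only-at anti {S} {v} FS v∈S
    with minimal-⊆ (meetsAll? F?) (∁ S ∪ ⁅ v ⁆) (∁∪⁅⁆-meetsAll anti FS v∈S)
  ... | T , T⊆∁S∪v , dualT = T , dualT , only-v
    where
    only-v : ∀ {w} → w ∈ T → w ∈ S → w ≡ v
    only-v {w} w∈T w∈S with x∈p∪q⁻ (∁ S) ⁅ v ⁆ (T⊆∁S∪v w∈T)
    ... | inj₁ w∈∁S = ⊥-elim (x∈∁p⇒x∉p w∈∁S w∈S)
    ... | inj₂ w∈⁅v⁆ = x∈⁅y⁆⇒x≡y v w∈⁅v⁆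

  edge⇒dual² : Antichain F → ∀ {S} → F S → Dual (Dual F) S
  edge⇒dual² anti {S} FS = edge-meetsAll-dual FS , λ S′ S′⊆S S′-meetsAll →
    ⊆-antisym S′⊆S (S⊆S′ S′ S′⊆S S′-meetsAll)
    where
    S⊆S′ : ∀ S′ → S′ ⊆ S → MeetsAll (Dual F) S′ → S ⊆ S′
    S⊆S′ S′ S′⊆S S′-meetsAll v∈S with dual-meets-only-at anti FS v∈S
    ... | T , dualT , only-v with S′-meetsAll T dualT
    ...   | w , w∈S′ , w∈T = subst (_∈ S′) (only-v w∈T (S′⊆S w∈S′)) w∈S′

  dual²⇒edge : ∀ {S} → Dual (Dual F) S → F S
  dual²⇒edge (S-meetsAll , minS) with meetsAll-dual⇒⊇edge S-meetsAll
  ... | E , FE , E⊆S = subst F (minS E E⊆S (edge-meetsAll-dual FE)) FE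

  dual-involutive : Antichain F → Dual (Dual F) ≐ F
  dual-involutive anti = dual²⇒edge , edge⇒dual² anti

meetsAll-antitone : {F F′ : Family n} →
  (∀ {S} → F′ S → F S) → ∀ {T} → MeetsAll F T → MeetsAll F′ T
meetsAll-antitone F′⊆F T-meetsAll S F′S = T-meetsAll S (F′⊆F F′S)

dual-cong : {F F′ : Family n} → F ≐ F′ → Dual F ≐ Dual F′
dual-cong F≐F′ = dual-⊆ F≐F′ , dual-⊆ (≐-sym F≐F′)
  where
  dual-⊆ : ∀ {F F′ : Family n} → F ≐ F′ → ∀ {T} → Dual F T → Dual F′ T
  dual-⊆ (F⊆F′ , F′⊆F) (T-meetsAll , minT) =
    meetsAll-antitone F′⊆F T-meetsAll ,
    λ T′ T′⊆T T′-meetsAll → minT T′ T′⊆T (meetsAll-antitone F⊆F′ T′-meetsAll)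

conformal-cong : {F F′ : Family n} → F ≐ F′ → Conformal F → Conformal F′
conformal-cong (F⊆F′ , F′⊆F) conformal U pairs-covered =
  map₂ (map₁ F⊆F′) (conformal U λ u v u∈U v∈U u≢v →
    map₂ (map₁ F′⊆F) (pairs-covered u v u∈U v∈U u≢v))

clique? : (G : Graph n) → Decidable (Clique G)
clique? G K = all? λ u → all? λ v →
  (u ∈? K) →-dec ((v ∈? K) →-dec (¬? (u ≟ v) →-dec (adj G u v Bool.≟ true)))

maximalCliques-conformal : (G : Graph n) → Conformal (MaximalClique G)
maximalCliques-conformal G U pairs-covered = maximal-⊇ (clique? G) U U-clique
  where
  U-clique : Clique G U
  U-clique u v u∈U v∈U u≢v with pairs-covered u v u∈U v∈U u≢v
  ... | K , (K-clique , _) , u∈K , v∈K = K-clique u v u∈K v∈K u≢v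

CoEdge : Family n → Fin n → Fin n → Set
CoEdge F u v = u ≢ v × ∃ λ S → F S × u ∈ S × v ∈ S

module _ {F : Family n} (F? : Decidable F) where

  coEdge? : ∀ u v → Dec (CoEdge F u v)
  coEdge? u v =
    ¬? (u ≟ v) ×-dec anySubset? (λ S → F? S ×-dec ((u ∈? S) ×-dec (v ∈? S)))

  coEdge-sym : ∀ {u v} → CoEdge F u v → CoEdge F v u
  coEdge-sym (u≢v , S , FS , u∈S , v∈S) = u≢v ∘ sym , S , FS , v∈S , u∈S

  twoSection : Graph n
  twoSection = record
    { adj     = λ u v → does (coEdge? u v)
    ; adj-sym = λ u v → does-⇔ (mk⇔ coEdge-sym coEdge-sym) (coEdge? u v) (coEdge? v u)
    ; irrefl  = λ v adj-vv → proj₁ (does≡true⇒ (coEdge? v v) adj-vv) refl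
    }

  adj-twoSection⇒coEdge : ∀ {u v} → adj twoSection u v ≡ true → CoEdge F u v
  adj-twoSection⇒coEdge {u} {v} = does≡true⇒ (coEdge? u v)

  coEdge⇒adj-twoSection : ∀ {u v} → CoEdge F u v → adj twoSection u v ≡ true
  coEdge⇒adj-twoSection {u} {v} = dec-true (coEdge? u v)

  edge⇒clique : ∀ {S} → F S → Clique twoSection S
  edge⇒clique {S} FS u v u∈S v∈S u≢v = coEdge⇒adj-twoSection (u≢v , S , FS , u∈S , v∈S)

  clique⇒⊆edge : Conformal F → ∀ {K} → Clique twoSection K → ∃ λ S → F S × K ⊆ S
  clique⇒⊆edge conformal {K} K-clique = conformal K λ u v u∈K v∈K u≢v →
    proj₂ (adj-twoSection⇒coEdge (K-clique u v u∈K v∈K u≢v))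

  maximalClique-twoSection : Antichain F → Conformal F → MaximalClique twoSection ≐ F
  maximalClique-twoSection anti conformal = maximal⇒edge , edge⇒maximal
    where
    maximal⇒edge : ∀ {K} → MaximalClique twoSection K → F K
    maximal⇒edge (K-clique , maxK) with clique⇒⊆edge conformal K-clique
    ... | S , FS , K⊆S = subst F (maxK S (edge⇒clique FS) K⊆S) FS

    edge⇒maximal : ∀ {K} → F K → MaximalClique twoSection K
    edge⇒maximal {K} FK = edge⇒clique FK , λ K′ K′-clique K⊆K′ →
      ⊆-antisym (K′⊆K K′-clique K⊆K′) K⊆K′
      where
      K′⊆K : ∀ {K′} → Clique twoSection K′ → K ⊆ K′ → K′ ⊆ K
      K′⊆K {K′} K′-clique K⊆K′ with clique⇒⊆edge conformal K′-clique
      ... | S , FS , K′⊆S = subst (K′ ⊆_) (sym (anti K S FK FS (⊆-trans K⊆K′ K′⊆S))) K′⊆S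

proposition3p1 : (n : ℕ) (H : Hypergraph (suc n)) →
    (Sperner H × Conformal (DualEdge H)) ⇔
      (∃ λ (G : Graph (suc n)) →
        ∀ (S : Subset (suc n)) → (edge H S ≡ true) ⇔ MinimalCliqueTransversal G S)
proposition3p1 n H = mk⇔ sperner∧conformal⇒graph graph⇒sperner∧conformal
  where
  sperner∧conformal⇒graph : Sperner H × Conformal (DualEdge H) →
    ∃ λ G → ∀ S → Edge H S ⇔ MinimalCliqueTransversal G S
  sperner∧conformal⇒graph (sperner , conformal) = twoSection dual? , ≐⇒⇔ (≐-sym
    (≐-trans (dual-cong (maximalClique-twoSection dual? minimal-antichain conformal))
             (dual-involutive (edge? H) sperner)))
    where
    dual? : Decidable (DualEdge H)
    dual? = minimal? (meetsAll? (edge? H))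

  graph⇒sperner∧conformal : (∃ λ G → ∀ S → Edge H S ⇔ MinimalCliqueTransversal G S) →
    Sperner H × Conformal (DualEdge H)
  graph⇒sperner∧conformal (G , H⇔transversals) =
    (λ S T HS HT →
      minimal-antichain S T (proj₁ H≐transversals HS) (proj₁ H≐transversals HT)) ,
    conformal-cong (≐-sym dual≐cliques) (maximalCliques-conformal G)
    where
    H≐transversals : Edge H ≐ MinimalCliqueTransversal G
    H≐transversals = ⇔⇒≐ H⇔transversals

    dual≐cliques : DualEdge H ≐ MaximalClique G
    dual≐cliques = ≐-trans (dual-cong H≐transversals)
                           (dual-involutive (maximal? (clique? G)) maximal-antichain)
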